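{- Let $X,Y\subseteq\mathbb{N}=\{1,2,3,\dots\}$. For every integer $n\ge 1$, $$P_{n+1}^{X,Y}(x,y)=\begin{cases} y\cdot\Phi_{n+1}\big(P_n^{X,Y}(x,y)\big) & \text{if } n+1\notin X \text{ and } n+1\notin Y,\\ \Phi_{n+1}\big(P_n^{X,Y}(x,y)\big) & \text{if } n+1\notin X \text{ and } n+1\in Y,\\ y\cdot\Psi_{n+1}\big(P_n^{X,Y}(x,y)\big) & \text{if } n+1\in X \text{ and } n+1\notin Y,\\ \Psi_{n+1}\big(P_n^{X,Y}(x,y)\big) & \text{if } n+1\in X \text{ and } n+1\in Y.\end{cases}$$
   Context: $S_n$ is the set of permutations of $[n]=\{1,\dots,n\}$, written $\sigma=\sigma_1\sigma_2\cdots\sigma_n$. For $X,Y\subseteq\mathbb{N}$, $Des_{X,Y}(\sigma)=\{i:\sigma_i>\sigma_{i+1},\ \sigma_i\in X,\ \sigma_{i+1}\in Y\}$ and $des_{X,Y}(\sigma)=|Des_{X,Y}(\sigma)|$. For a set $S\subseteq\mathbb{N}$, $S_n^c=[n]\setminus S$. Define $P_0^{X,Y}(x,y)=1$ and for $n\ge1$, $P_n^{X,Y}(x,y)=\sum_{\sigma\in S_n}x^{des_{X,Y}(\sigma)}y^{|Y_n^c|}$. The operators $\Phi_{n+1}$ and $\Psi_{n+1}$ are the linear maps on polynomials in $x,y$ defined on monomials by $\Phi_{n+1}(x^sy^t)=s\,x^{s-1}y^t+(n+1-s)x^sy^t$ and $\Psi_{n+1}(x^sy^t)=(s+t+1)x^sy^t+(n-s-t)x^{s+1}y^t$.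 -}

module Defs where

open import Level using (0ℓ)
open import Data.Bool using (Bool; true; false; if_then_else_; _∧_)
open import Data.Nat as ℕ using (ℕ; zero; suc; _<?_; _≟_)
open import Data.Integer as ℤ using (ℤ; +_)
open import Data.List using (List; []; _∷_; map; concatMap; filter; length; upTo; foldr)
open import Data.Product using (_×_; _,_)
open import Relation.Nullary using (does; ¬?)
open import Relation.Unary using (Pred; Decidable)
open import Data.List.Relation.Unary.Unique.DecPropositional _≟_ using (unique?)

Subset : Set₁
Subset = Pred ℕ 0ℓ

[_] : ℕ → List ℕ
[ n ] = map suc (upTo n)

words : ℕ → ℕ → List (List ℕ)
words n zero = [] ∷ []
words n (suc k) = concatMap (λ w → map (_∷ w) [ n ]) (words n k)

-- S_n : all permutations of [n], in one-line notation σ₁σ₂⋯σₙ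
-- (words of length n over [n] with pairwise distinct letters)
S : ℕ → List (List ℕ)
S n = filter unique? (words n n)

des : {X Y : Subset} → Decidable X → Decidable Y → List ℕ → ℕ
des X? Y? (a ∷ b ∷ rest) =
  (if does (b <? a) ∧ does (X? a) ∧ does (Y? b) then 1 else 0) ℕ.+ des X? Y? (b ∷ rest)
des X? Y? _ = 0

compSize : {Y : Subset} → Decidable Y → ℕ → ℕ
compSize Y? n = length (filter (λ i → ¬? (Y? i)) [ n ])

-- Polynomials in x, y with integer coefficients, as formal sums of
-- terms (c , s , t) standing for c · x^s y^t.
Poly : Set
Poly = List (ℤ × ℕ × ℕ)

coeff : Poly → ℕ → ℕ → ℤ
coeff p s t = foldr (λ { (c , a , b) r → (if does (a ≟ s) ∧ does (b ≟ t) then c else + 0) ℤ.+ r }) (+ 0) p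

_≈ₚ_ : Poly → Poly → Set
p ≈ₚ q = ∀ s t → coeff p s t ≡ coeff q s t
  where open import Relation.Binary.PropositionalEquality using (_≡_)

P : {X Y : Subset} → Decidable X → Decidable Y → ℕ → Poly
P X? Y? zero = (+ 1 , 0 , 0) ∷ []
P X? Y? n@(suc _) = map (λ σ → (+ 1 , des X? Y? σ , compSize Y? n)) (S n)

linear : (ℕ → ℕ → Poly) → Poly → Poly
linear f = concatMap (λ { (c , s , t) → map (λ { (d , a , b) → (c ℤ.* d , a , b) }) (f s t) })

Φ : ℕ → Poly → Poly
Φ m = linear (λ s t → (+ s , s ℕ.∸ 1 , t) ∷ ((+ m) ℤ.- (+ s) , s , t) ∷ [])

Ψ : ℕ → Poly → Poly
Ψ m = linear (λ s t → (+ (s ℕ.+ t ℕ.+ 1) , s , t) ∷ ((+ m) ℤ.- + 1 ℤ.- (+ s) ℤ.- (+ t) , suc s , t) ∷ [])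

yMul : Poly → Poly
yMul = map (λ { (c , s , t) → (c , s , suc t) })

-- Every permutation of [n+1] arises in exactly one way by inserting n+1 into a
-- permutation σ of [n], so P_{n+1} is the sum over σ of the generating terms of
-- the n+1 insertions into σ. Since n+1 exceeds every other letter, inserting it
-- between σᵢ and σᵢ₊₁ only breaks the descent (σᵢ, σᵢ₊₁), if there is one, and
-- creates the descent (n+1, σᵢ₊₁) exactly when n+1 ∈ X and σᵢ₊₁ ∈ Y. Counting
-- the positions that lose, keep or gain a descent gives Φ_{n+1} (when n+1 ∉ X)
-- or Ψ_{n+1} (when n+1 ∈ X) applied to x^des(σ) y^|Y_n^c|; the extra factor y
-- records whether n+1 ∉ Y.
module Submission where

open import Defs
open import Data.Bool using (true; false; if_then_else_; _∧_)
open import Data.Nat as ℕ using (ℕ; zero; suc; _≥_; _≤_; _<_; _≟_; _<?_; _∸_; z≤n; s≤s; s≤s⁻¹)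
import Data.Nat.Properties as ℕₚ
open import Data.Integer using (ℤ; +_; _+_; _-_)
import Data.Integer.Properties as ℤₚ
open import Data.Integer.Tactic.RingSolver using (solve-∀)
open import Data.List using (List; []; _∷_; _++_; _∷ʳ_; map; concatMap; filter; length; upTo; drop)
open import Data.List.Properties
  using (map-id; map-∘; map-cong; map-++; map-concatMap; concatMap-++; length-map; length-upTo; upTo-∷ʳ;
         ∷-injectiveˡ; ∷-injectiveʳ; filter-accept; filter-reject; filter-all)
open import Data.List.Membership.Propositional using (_∈_; _∉_; find; lose)
open import Data.List.Membership.Propositional.Properties
  using (∈-map⁻; ∈-map⁺; ∈-concatMap⁺; ∈-concatMap⁻; ∈-filter⁺; ∈-filter⁻; ∈-upTo⁻; ∈-∃++)
open import Data.List.Membership.Propositional.Properties.WithK using (unique∧set⇒bag)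
open import Data.List.Relation.Binary.Subset.Propositional using (_⊆_)
open import Data.List.Relation.Binary.Disjoint.Propositional using (Disjoint)
open import Data.List.Relation.Unary.Any using (here; there)
open import Data.List.Relation.Unary.All as All using (All; []; _∷_)
open import Data.List.Relation.Unary.AllPairs using ([]; _∷_)
open import Data.List.Relation.Unary.Unique.Propositional using (Unique)
import Data.List.Relation.Unary.Unique.Propositional.Properties as Unique
open import Data.List.Relation.Unary.Unique.DecPropositional _≟_ using (unique?)
open import Data.List.Relation.Binary.Permutation.Propositional
  using (_↭_; prep; swap; ↭-refl; ↭-sym; ↭-trans; ↭⇒↭ₛ)
  renaming (refl to ↭-reflexive; trans to ↭-transitive)
open import Data.List.Relation.Binary.Permutation.Propositional.Properties
  using (∈-resp-↭; ↭-length; shift; drop-∷; ∷↭∷ʳ; filter-↭; map⁺)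
import Data.List.Relation.Binary.Permutation.Setoid.Properties as ↭ₛ
open import Data.List.Relation.Binary.BagAndSetEquality using (∼bag⇒↭)
open import Data.Product using (_×_; _,_; ∃₂; proj₂)
open import Function using (_∘_; mk⇔)
open import Level using (0ℓ)
open import Relation.Binary using (Setoid; IsEquivalence)
import Relation.Binary.Reasoning.Setoid as SetoidReasoning
open import Relation.Binary.PropositionalEquality
  using (_≡_; _≢_; refl; sym; trans; cong; cong₂; subst; setoid; module ≡-Reasoning)
open import Relation.Nullary using (¬_; Dec; yes; no; does; ¬?; contradiction)
open import Relation.Nullary.Decidable using (dec-true; dec-false; _×-dec_)
open import Relation.Unary using (Decidable)

private variable
  A B : Set

Unique-resp-↭ : {xs ys : List A} → xs ↭ ys → Unique xs → Unique ys
Unique-resp-↭ {A} xs↭ys = ↭ₛ.Unique-resp-↭ (setoid A) (↭⇒↭ₛ xs↭ys)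

Unique-concatMap⁺ : {f : A → List B} (r : B → A) {xs : List A} → Unique xs →
                    (∀ {x} → x ∈ xs → Unique (f x)) →
                    (∀ {x y} → x ∈ xs → y ∈ f x → r y ≡ x) →
                    Unique (concatMap f xs)
Unique-concatMap⁺ r {[]} _ _ _ = []
Unique-concatMap⁺ {f = f} r {x ∷ xs} (x∉xs ∷ !xs) !f r-inv =
  Unique.++⁺ (!f (here refl)) (Unique-concatMap⁺ r !xs (!f ∘ there) (r-inv ∘ there)) disjoint
  where
  disjoint : Disjoint (f x) (concatMap f xs)
  disjoint (y∈fx , y∈fxs) with find (∈-concatMap⁻ f y∈fxs)
  ... | x′ , x′∈xs , y∈fx′ =
    All.lookup x∉xs x′∈xs (trans (sym (r-inv (here refl) y∈fx)) (r-inv (there x′∈xs) y∈fx′))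

unique∧set⇒↭ : {xs ys : List A} → Unique xs → Unique ys → xs ⊆ ys → ys ⊆ xs → xs ↭ ys
unique∧set⇒↭ !xs !ys xs⊆ys ys⊆xs = ∼bag⇒↭ (unique∧set⇒bag !xs !ys (mk⇔ xs⊆ys ys⊆xs))

unique∧⊆∧length≤⇒↭ : {xs ys : List A} → Unique xs → xs ⊆ ys → length ys ≤ length xs → xs ↭ ys
unique∧⊆∧length≤⇒↭ {xs = []} {[]} _ _ _ = ↭-refl
unique∧⊆∧length≤⇒↭ {xs = x ∷ xs} (x∉xs ∷ !xs) xs⊆ys len with ∈-∃++ (xs⊆ys (here refl))
... | as , bs , refl =
  ↭-trans (prep x (unique∧⊆∧length≤⇒↭ !xs xs⊆as++bs len′)) (↭-sym (shift x as bs))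
  where
  xs⊆as++bs : xs ⊆ as ++ bs
  xs⊆as++bs z∈xs with ∈-resp-↭ (shift x as bs) (xs⊆ys (there z∈xs))
  ... | here z≡x = contradiction (sym z≡x) (All.lookup x∉xs z∈xs)
  ... | there z∈as++bs = z∈as++bs
  len′ : length (as ++ bs) ≤ length xs
  len′ = s≤s⁻¹ (subst (_≤ suc (length xs)) (↭-length (shift x as bs)) len)

-- Permutations of [n] by insertion of the largest letter

∈[]⇒≤ : ∀ {x n} → x ∈ [ n ] → x ≤ n
∈[]⇒≤ x∈[n] with ∈-map⁻ suc x∈[n]
... | k , k∈upTo , refl = ∈-upTo⁻ k∈upTo

length-[] : ∀ n → length [ n ] ≡ n
length-[] n = trans (length-map suc (upTo n)) (length-upTo n)

Unique-[] : ∀ n → Unique [ n ]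
Unique-[] n = Unique.map⁺ ℕₚ.suc-injective (Unique.upTo⁺ n)

[suc]↭ : ∀ n → [ suc n ] ↭ suc n ∷ [ n ]
[suc]↭ n = subst (_↭ suc n ∷ [ n ]) [n]∷ʳsuc-n≡[suc-n] (↭-sym (∷↭∷ʳ (suc n) [ n ]))
  where
  [n]∷ʳsuc-n≡[suc-n] : [ n ] ∷ʳ suc n ≡ [ suc n ]
  [n]∷ʳsuc-n≡[suc-n] = trans (sym (map-++ suc (upTo n) (n ∷ []))) (cong (map suc) (upTo-∷ʳ n))

∈-words⁻ : ∀ n k {σ} → σ ∈ words n k → length σ ≡ k × All (_∈ [ n ]) σ
∈-words⁻ n zero (here refl) = refl , []
∈-words⁻ n (suc k) σ∈ with find (∈-concatMap⁻ (λ w → map (_∷ w) [ n ]) {xs = words n k} σ∈)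
... | w , w∈ , σ∈w with ∈-map⁻ (_∷ w) σ∈w
... | x , x∈ , refl with ∈-words⁻ n k w∈
... | length≡ , w⊆[n] = cong suc length≡ , x∈ ∷ w⊆[n]

∈-words⁺ : ∀ n {σ} → All (_∈ [ n ]) σ → σ ∈ words n (length σ)
∈-words⁺ n [] = here refl
∈-words⁺ n {x ∷ σ} (x∈ ∷ σ⊆[n]) =
  ∈-concatMap⁺ (λ w → map (_∷ w) [ n ]) (lose (∈-words⁺ n σ⊆[n]) (∈-map⁺ (_∷ σ) x∈))

Unique-words : ∀ n k → Unique (words n k)
Unique-words n zero = [] ∷ []
Unique-words n (suc k) =
  Unique-concatMap⁺ (drop 1) (Unique-words n k) (λ _ → Unique.map⁺ ∷-injectiveˡ (Unique-[] n)) tail≡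
  where
  tail≡ : ∀ {w τ} → w ∈ words n k → τ ∈ map (_∷ w) [ n ] → drop 1 τ ≡ w
  tail≡ {w} _ τ∈ with ∈-map⁻ (_∷ w) τ∈
  ... | _ , _ , refl = refl

Unique-S : ∀ n → Unique (S n)
Unique-S n = Unique.filter⁺ unique? (Unique-words n n)

∈S⇒↭ : ∀ n {σ} → σ ∈ S n → σ ↭ [ n ]
∈S⇒↭ n σ∈ with ∈-filter⁻ unique? σ∈
... | σ∈words , !σ with ∈-words⁻ n n σ∈words
... | length≡ , σ⊆[n] =
  unique∧⊆∧length≤⇒↭ !σ (All.lookup σ⊆[n]) (ℕₚ.≤-reflexive (trans (length-[] n) (sym length≡)))

↭⇒∈S : ∀ n {σ} → σ ↭ [ n ] → σ ∈ S n
↭⇒∈S n {σ} σ↭[n] = ∈-filter⁺ unique? σ∈words (Unique-resp-↭ (↭-sym σ↭[n]) (Unique-[] n))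
  where
  σ∈words : σ ∈ words n n
  σ∈words = subst (λ k → σ ∈ words n k) (trans (↭-length σ↭[n]) (length-[] n))
                  (∈-words⁺ n (All.tabulate (∈-resp-↭ σ↭[n])))

inserts : ℕ → List ℕ → List (List ℕ)
inserts m [] = (m ∷ []) ∷ []
inserts m (b ∷ σ) = (m ∷ b ∷ σ) ∷ map (b ∷_) (inserts m σ)

∈-inserts⁻ : ∀ m σ {τ} → τ ∈ inserts m σ → ∃₂ λ as bs → σ ≡ as ++ bs × τ ≡ as ++ m ∷ bs
∈-inserts⁻ m [] (here refl) = [] , [] , refl , refl
∈-inserts⁻ m (b ∷ σ) (here refl) = [] , b ∷ σ , refl , refl
∈-inserts⁻ m (b ∷ σ) (there τ∈) with ∈-map⁻ (b ∷_) τ∈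
... | τ′ , τ′∈ , refl with ∈-inserts⁻ m σ τ′∈
... | as , bs , refl , refl = b ∷ as , bs , refl , refl

∈-inserts⁺ : ∀ m as bs → as ++ m ∷ bs ∈ inserts m (as ++ bs)
∈-inserts⁺ m [] [] = here refl
∈-inserts⁺ m [] (b ∷ bs) = here refl
∈-inserts⁺ m (a ∷ as) bs = there (∈-map⁺ (a ∷_) (∈-inserts⁺ m as bs))

Unique-inserts : ∀ m σ → m ∉ σ → Unique (inserts m σ)
Unique-inserts m [] _ = [] ∷ []
Unique-inserts m (b ∷ σ) m∉b∷σ =
  All.tabulate m∷b∷σ≢ ∷ Unique.map⁺ ∷-injectiveʳ (Unique-inserts m σ (m∉b∷σ ∘ there))
  where
  m∷b∷σ≢ : ∀ {τ} → τ ∈ map (b ∷_) (inserts m σ) → m ∷ b ∷ σ ≢ τ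
  m∷b∷σ≢ τ∈ m∷b∷σ≡τ with ∈-map⁻ (b ∷_) τ∈
  ... | _ , _ , refl = m∉b∷σ (here (∷-injectiveˡ m∷b∷σ≡τ))

remove : ℕ → List ℕ → List ℕ
remove m = filter (λ z → ¬? (z ≟ m))

remove-∉ : ∀ m σ → m ∉ σ → remove m σ ≡ σ
remove-∉ m σ m∉σ = filter-all (λ z → ¬? (z ≟ m)) (All.tabulate (λ z∈σ z≡m → m∉σ (subst (_∈ σ) z≡m z∈σ)))

remove-inserts : ∀ m σ {τ} → m ∉ σ → τ ∈ inserts m σ → remove m τ ≡ σ
remove-inserts m [] _ (here refl) = filter-reject (λ z → ¬? (z ≟ m)) (λ m≢m → m≢m refl)
remove-inserts m (b ∷ σ) m∉b∷σ (here refl) =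
  trans (filter-reject (λ z → ¬? (z ≟ m)) (λ m≢m → m≢m refl)) (remove-∉ m (b ∷ σ) m∉b∷σ)
remove-inserts m (b ∷ σ) m∉b∷σ (there τ∈) with ∈-map⁻ (b ∷_) τ∈
... | τ′ , τ′∈ , refl =
  trans (filter-accept (λ z → ¬? (z ≟ m)) (λ b≡m → m∉b∷σ (here (sym b≡m))))
        (cong (b ∷_) (remove-inserts m σ (m∉b∷σ ∘ there) τ′∈))

S-suc↭ : ∀ n → S (suc n) ↭ concatMap (inserts (suc n)) (S n)
S-suc↭ n = unique∧set⇒↭ (Unique-S (suc n)) Unique-insertions ⊆insertions insertions⊆
  where
  m = suc n
  m∉ : ∀ {σ} → σ ∈ S n → m ∉ σ
  m∉ σ∈ m∈σ = ℕₚ.<-irrefl refl (∈[]⇒≤ (∈-resp-↭ (∈S⇒↭ n σ∈) m∈σ))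
  Unique-insertions : Unique (concatMap (inserts m) (S n))
  Unique-insertions = Unique-concatMap⁺ (remove m) (Unique-S n)
    (λ {σ} σ∈ → Unique-inserts m σ (m∉ σ∈)) (λ {σ} σ∈ → remove-inserts m σ (m∉ σ∈))
  ⊆insertions : S m ⊆ concatMap (inserts m) (S n)
  ⊆insertions τ∈ = ⊆insertions′ (↭-trans (∈S⇒↭ m τ∈) ([suc]↭ n))
    where
    ⊆insertions′ : ∀ {τ} → τ ↭ m ∷ [ n ] → τ ∈ concatMap (inserts m) (S n)
    ⊆insertions′ τ↭ with ∈-∃++ (∈-resp-↭ (↭-sym τ↭) (here refl))
    ... | as , bs , refl = ∈-concatMap⁺ (inserts m)
      (lose (↭⇒∈S n (drop-∷ (↭-trans (↭-sym (shift m as bs)) τ↭))) (∈-inserts⁺ m as bs))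
  insertions⊆ : concatMap (inserts m) (S n) ⊆ S m
  insertions⊆ τ∈ with find (∈-concatMap⁻ (inserts m) τ∈)
  ... | σ , σ∈ , τ∈inserts with ∈-inserts⁻ m σ τ∈inserts
  ... | as , bs , refl , refl =
    ↭⇒∈S m (↭-trans (shift m as bs) (↭-trans (prep m (∈S⇒↭ n σ∈)) (↭-sym ([suc]↭ n))))

-- Polynomials up to equality of coefficients

-- Wrapping ≈ₚ in a record lets Agda infer both polynomials from a proof.
infix 4 _≋_
record _≋_ (p q : Poly) : Set where
  constructor mk≋
  field coeff-≡ : p ≈ₚ q
open _≋_

≋-isEquivalence : IsEquivalence _≋_
≋-isEquivalence = record
  { refl = mk≋ λ _ _ → refl
  ; sym = λ (mk≋ p≈q) → mk≋ λ s t → sym (p≈q s t)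
  ; trans = λ (mk≋ p≈q) (mk≋ q≈r) → mk≋ λ s t → trans (p≈q s t) (q≈r s t)
  }

≋-setoid : Setoid 0ℓ 0ℓ
≋-setoid = record { isEquivalence = ≋-isEquivalence }

open Setoid ≋-setoid public using () renaming (refl to ≋-refl; sym to ≋-sym; trans to ≋-trans; reflexive to ≡⇒≋)
module ≋-Reasoning = SetoidReasoning ≋-setoid

Term : Set
Term = ℤ × ℕ × ℕ

coeffᵗ : Term → ℕ → ℕ → ℤ
coeffᵗ (c , a , b) s t = if does (a ≟ s) ∧ does (b ≟ t) then c else + 0

∷-cong : ∀ x {p q} → p ≋ q → x ∷ p ≋ x ∷ q
∷-cong x (mk≋ p≈q) = mk≋ λ s t → cong (λ r → coeffᵗ x s t + r) (p≈q s t)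

∷-swap : ∀ x y p → x ∷ y ∷ p ≋ y ∷ x ∷ p
∷-swap x y p = mk≋ λ s t → +-left-comm (coeffᵗ x s t) (coeffᵗ y s t) (coeff p s t)
  where
  +-left-comm : ∀ a b r → a + (b + r) ≡ b + (a + r)
  +-left-comm = solve-∀

∷-merge : ∀ {a b c s₀ t₀} p → a + b ≡ c → (a , s₀ , t₀) ∷ (b , s₀ , t₀) ∷ p ≋ (c , s₀ , t₀) ∷ p
∷-merge {a} {b} {s₀ = s₀} {t₀} p refl = mk≋ λ s t → merge (does (s₀ ≟ s) ∧ does (t₀ ≟ t)) (coeff p s t)
  where
  merge : ∀ B r → (if B then a else + 0) + ((if B then b else + 0) + r) ≡ (if B then a + b else + 0) + r
  merge true r = sym (ℤₚ.+-assoc a b r)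
  merge false r = ℤₚ.+-identityˡ _

∷-drop-zero : ∀ {s₀ t₀} p → (+ 0 , s₀ , t₀) ∷ p ≋ p
∷-drop-zero {s₀} {t₀} p = mk≋ λ s t → zero+ (does (s₀ ≟ s) ∧ does (t₀ ≟ t)) (coeff p s t)
  where
  zero+ : ∀ B r → (if B then + 0 else + 0) + r ≡ r
  zero+ true r = ℤₚ.+-identityˡ r
  zero+ false r = ℤₚ.+-identityˡ r

coeff-++ : ∀ p q s t → coeff (p ++ q) s t ≡ coeff p s t + coeff q s t
coeff-++ [] q s t = sym (ℤₚ.+-identityˡ _)
coeff-++ (x ∷ p) q s t = trans (cong (λ r → coeffᵗ x s t + r) (coeff-++ p q s t)) (sym (ℤₚ.+-assoc (coeffᵗ x s t) _ _))

++-cong : ∀ {p p′ q q′} → p ≋ p′ → q ≋ q′ → p ++ q ≋ p′ ++ q′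
++-cong {p} {p′} {q} {q′} (mk≋ p≈p′) (mk≋ q≈q′) = mk≋ λ s t → begin
  coeff (p ++ q) s t            ≡⟨ coeff-++ p q s t ⟩
  coeff p s t + coeff q s t     ≡⟨ cong₂ _+_ (p≈p′ s t) (q≈q′ s t) ⟩
  coeff p′ s t + coeff q′ s t   ≡⟨ coeff-++ p′ q′ s t ⟨
  coeff (p′ ++ q′) s t          ∎
  where open ≡-Reasoning

↭⇒≋ : ∀ {p q} → p ↭ q → p ≋ q
↭⇒≋ ↭-reflexive = ≋-refl
↭⇒≋ (prep x p↭q) = ∷-cong x (↭⇒≋ p↭q)
↭⇒≋ (swap x y p↭q) = ≋-trans (∷-cong x (∷-cong y (↭⇒≋ p↭q))) (∷-swap x y _)
↭⇒≋ (↭-transitive p↭q q↭r) = ≋-trans (↭⇒≋ p↭q) (↭⇒≋ q↭r)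

x^_·_ : ℕ → Poly → Poly
x^ e · p = map (λ { (c , s , t) → (c , e ℕ.+ s , t) }) p

coeff-x^suc·-zero : ∀ e p t → coeff (x^ suc e · p) 0 t ≡ + 0
coeff-x^suc·-zero e [] t = refl
coeff-x^suc·-zero e (_ ∷ p) t = trans (ℤₚ.+-identityˡ _) (coeff-x^suc·-zero e p t)

coeff-x^suc·-suc : ∀ e p s t → coeff (x^ suc e · p) (suc s) t ≡ coeff (x^ e · p) s t
coeff-x^suc·-suc e [] s t = refl
coeff-x^suc·-suc e ((c , a , b) ∷ p) s t = cong (λ r → coeffᵗ (c , e ℕ.+ a , b) s t + r) (coeff-x^suc·-suc e p s t)

x^-cong : ∀ e {p q} → p ≋ q → x^ e · p ≋ x^ e · q
x^-cong zero {p} {q} p≋q = ≋-trans (≡⇒≋ (map-id p)) (≋-trans p≋q (≡⇒≋ (sym (map-id q))))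
x^-cong (suc e) {p} {q} p≋q = mk≋ λ where
  zero t → trans (coeff-x^suc·-zero e p t) (sym (coeff-x^suc·-zero e q t))
  (suc s) t → trans (coeff-x^suc·-suc e p s t)
                (trans (coeff-≡ (x^-cong e p≋q) s t) (sym (coeff-x^suc·-suc e q s t)))

Additive : (Poly → Poly) → Set
Additive F = F [] ≡ [] × (∀ p q → F (p ++ q) ≡ F p ++ F q)

Φ-additive : ∀ m → Additive (Φ m)
Φ-additive m = refl , λ p q → concatMap-++ _ p q

Ψ-additive : ∀ m → Additive (Ψ m)
Ψ-additive m = refl , λ p q → concatMap-++ _ p q

yMul-∘-additive : ∀ F → Additive F → Additive (yMul ∘ F)
yMul-∘-additive F (F[]≡[] , F-++) =
  cong yMul F[]≡[] , λ p q → trans (cong yMul (F-++ p q)) (map-++ _ (F p) (F q))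

concatMap-≋ : ∀ F → Additive F → {h : A → Poly} {g : A → Term} (xs : List A) →
              (∀ {x} → x ∈ xs → h x ≋ F (g x ∷ [])) → concatMap h xs ≋ F (map g xs)
concatMap-≋ F (F[]≡[] , _) [] _ = ≡⇒≋ (sym F[]≡[])
concatMap-≋ F F-additive@(_ , F-++) {h} {g} (x ∷ xs) h≋F = begin
  h x ++ concatMap h xs          ≈⟨ ++-cong (h≋F (here refl)) (concatMap-≋ F F-additive xs (h≋F ∘ there)) ⟩
  F (g x ∷ []) ++ F (map g xs)   ≡⟨ F-++ (g x ∷ []) (map g xs) ⟨
  F (map g (x ∷ xs))             ∎
  where open ≋-Reasoning

-- Φ_{k+1}(x^d y^c). For d = 0 the exponent d ∸ 1 is truncated, harmlessly, as its coefficient is 0.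
φ-terms : ℕ → ℕ → ℕ → Poly
φ-terms k d c = (+ d , d ∸ 1 , c) ∷ (+ suc k - + d , d , c) ∷ []

-- Ψ_{k+1}(x^d y^u) with the power of y replaced by c: the insertions carry y^|Y_{k+1}^c|,
-- whereas the coefficients of Ψ involve u = |Y_k^c|.
ψ-terms : ℕ → ℕ → ℕ → ℕ → Poly
ψ-terms k d u c = (+ (d ℕ.+ u ℕ.+ 1) , d , c) ∷ (+ suc k - + 1 - + d - + u , suc d , c) ∷ []

Φ-monomial : ∀ k d c → Φ (suc k) ((+ 1 , d , c) ∷ []) ≡ φ-terms k d c
Φ-monomial k d c =
  cong₂ (λ a b → (a , d ∸ 1 , c) ∷ (b , d , c) ∷ []) (ℤₚ.*-identityˡ _) (ℤₚ.*-identityˡ _)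

Ψ-monomial : ∀ k d u → Ψ (suc k) ((+ 1 , d , u) ∷ []) ≡ ψ-terms k d u u
Ψ-monomial k d u =
  cong₂ (λ a b → (a , d , u) ∷ (b , suc d , u) ∷ []) (ℤₚ.*-identityˡ _) (ℤₚ.*-identityˡ _)

φ-terms-step : ∀ {e} k d c → e ≤ 1 → (+ 1 , d , c) ∷ x^ e · φ-terms k d c ≋ φ-terms (suc k) (e ℕ.+ d) c
φ-terms-step k d c z≤n = begin
  (+ 1 , d , c) ∷ (+ d , d ∸ 1 , c) ∷ (+ suc k - + d , d , c) ∷ []
    ≈⟨ ∷-swap _ _ _ ⟩
  (+ d , d ∸ 1 , c) ∷ (+ 1 , d , c) ∷ (+ suc k - + d , d , c) ∷ []
    ≈⟨ ∷-cong _ (∷-merge [] (lemma (+ suc k) (+ d))) ⟩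
  φ-terms (suc k) d c
    ∎
  where
  open ≋-Reasoning
  lemma : ∀ K D → + 1 + (K - D) ≡ (+ 1 + K) - D
  lemma = solve-∀
φ-terms-step k zero c (s≤s z≤n) = begin
  (+ 1 , 0 , c) ∷ (+ 0 , 1 , c) ∷ (+ suc k - + 0 , 1 , c) ∷ []
    ≈⟨ ∷-cong _ (∷-drop-zero _) ⟩
  (+ 1 , 0 , c) ∷ (+ suc k - + 0 , 1 , c) ∷ []
    ≡⟨ cong (λ a → (+ 1 , 0 , c) ∷ (a , 1 , c) ∷ []) (lemma (+ suc k)) ⟩
  φ-terms (suc k) 1 c
    ∎
  where
  open ≋-Reasoning
  lemma : ∀ K → K - + 0 ≡ (+ 1 + K) - + 1
  lemma = solve-∀
φ-terms-step k (suc d) c (s≤s z≤n) = begin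
  (+ 1 , suc d , c) ∷ (+ suc d , suc d , c) ∷ (+ suc k - + suc d , suc (suc d) , c) ∷ []
    ≈⟨ ∷-merge _ refl ⟩
  (+ suc (suc d) , suc d , c) ∷ (+ suc k - + suc d , suc (suc d) , c) ∷ []
    ≡⟨ cong (λ a → (+ suc (suc d) , suc d , c) ∷ (a , suc (suc d) , c) ∷ []) (lemma (+ suc k) (+ suc d)) ⟩
  φ-terms (suc k) (suc (suc d)) c
    ∎
  where
  open ≋-Reasoning
  lemma : ∀ K D → K - D ≡ (+ 1 + K) - (+ 1 + D)
  lemma = solve-∀

ψ-terms-step-∈ : ∀ {e} k d u c → e ≤ 1 →
                 (+ 1 , suc d , c) ∷ x^ e · ψ-terms k d u c ≋ ψ-terms (suc k) (e ℕ.+ d) u c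
ψ-terms-step-∈ k d u c z≤n = begin
  (+ 1 , suc d , c) ∷ (+ (d ℕ.+ u ℕ.+ 1) , d , c) ∷ (+ suc k - + 1 - + d - + u , suc d , c) ∷ []
    ≈⟨ ∷-swap _ _ _ ⟩
  (+ (d ℕ.+ u ℕ.+ 1) , d , c) ∷ (+ 1 , suc d , c) ∷ (+ suc k - + 1 - + d - + u , suc d , c) ∷ []
    ≈⟨ ∷-cong _ (∷-merge [] (lemma (+ suc k) (+ d) (+ u))) ⟩
  ψ-terms (suc k) d u c
    ∎
  where
  open ≋-Reasoning
  lemma : ∀ K D U → + 1 + (K - + 1 - D - U) ≡ (+ 1 + K) - + 1 - D - U
  lemma = solve-∀
ψ-terms-step-∈ k d u c (s≤s z≤n) = begin
  (+ 1 , suc d , c) ∷ (+ (d ℕ.+ u ℕ.+ 1) , suc d , c) ∷ (+ suc k - + 1 - + d - + u , suc (suc d) , c) ∷ []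
    ≈⟨ ∷-merge _ refl ⟩
  (+ (suc d ℕ.+ u ℕ.+ 1) , suc d , c) ∷ (+ suc k - + 1 - + d - + u , suc (suc d) , c) ∷ []
    ≡⟨ cong (λ a → (+ (suc d ℕ.+ u ℕ.+ 1) , suc d , c) ∷ (a , suc (suc d) , c) ∷ []) (lemma (+ suc k) (+ d) (+ u)) ⟩
  ψ-terms (suc k) (suc d) u c
    ∎
  where
  open ≋-Reasoning
  lemma : ∀ K D U → K - + 1 - D - U ≡ (+ 1 + K) - + 1 - (+ 1 + D) - U
  lemma = solve-∀

ψ-terms-step-∉ : ∀ k d u c → (+ 1 , d , c) ∷ ψ-terms k d u c ≋ ψ-terms (suc k) d (suc u) c
ψ-terms-step-∉ k d u c = begin
  (+ 1 , d , c) ∷ (+ (d ℕ.+ u ℕ.+ 1) , d , c) ∷ (+ suc k - + 1 - + d - + u , suc d , c) ∷ []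
    ≈⟨ ∷-merge _ (cong (λ v → + (v ℕ.+ 1)) (sym (ℕₚ.+-suc d u))) ⟩
  (+ (d ℕ.+ suc u ℕ.+ 1) , d , c) ∷ (+ suc k - + 1 - + d - + u , suc d , c) ∷ []
    ≡⟨ cong (λ a → (+ (d ℕ.+ suc u ℕ.+ 1) , d , c) ∷ (a , suc d , c) ∷ []) (lemma (+ suc k) (+ d) (+ u)) ⟩
  ψ-terms (suc k) d (suc u) c
    ∎
  where
  open ≋-Reasoning
  lemma : ∀ K D U → K - + 1 - D - U ≡ (+ 1 + K) - + 1 - D - (+ 1 + U)
  lemma = solve-∀

-- Descents of the insertions

module _ {X Y : Subset} (X? : Decidable X) (Y? : Decidable Y) where

  IsDescent : ℕ → ℕ → Set
  IsDescent a b = b < a × X a × Y b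

  descent? : ∀ a b → Dec (IsDescent a b)
  descent? a b = b <? a ×-dec X? a ×-dec Y? b

  -- Definitionally the summand of des X? Y? (a ∷ b ∷ σ) contributed by the pair a, b.
  descent : ℕ → ℕ → ℕ
  descent a b = if does (descent? a b) then 1 else 0

  descent-yes : ∀ {a b} → IsDescent a b → descent a b ≡ 1
  descent-yes {a} {b} ab = cong (λ B → if B then 1 else 0) (dec-true (descent? a b) ab)

  descent-no : ∀ {a b} → ¬ IsDescent a b → descent a b ≡ 0
  descent-no {a} {b} ¬ab = cong (λ B → if B then 1 else 0) (dec-false (descent? a b) ¬ab)

  descent-< : ∀ {a b} → a < b → descent a b ≡ 0
  descent-< a<b = descent-no λ (b<a , _) → ℕₚ.<-asym a<b b<a

  descent≤1 : ∀ a b → descent a b ≤ 1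
  descent≤1 a b with does (descent? a b)
  ... | true = s≤s z≤n
  ... | false = z≤n

  -- No letter is below 0, so a leading 0 adds no descent: 0 can stand in front of
  -- every insertion position.
  des-0∷ : ∀ τ → des X? Y? (0 ∷ τ) ≡ des X? Y? τ
  des-0∷ [] = refl
  des-0∷ (_ ∷ _) = refl

  nonY : List ℕ → ℕ
  nonY σ = length (filter (λ i → ¬? (Y? i)) σ)

  nonY-∈ : ∀ {b} σ → Y b → nonY (b ∷ σ) ≡ nonY σ
  nonY-∈ σ b∈Y = cong length (filter-reject (λ i → ¬? (Y? i)) (λ b∉Y → b∉Y b∈Y))

  nonY-∉ : ∀ {b} σ → ¬ Y b → nonY (b ∷ σ) ≡ suc (nonY σ)
  nonY-∉ σ b∉Y = cong length (filter-accept (λ i → ¬? (Y? i)) b∉Y)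

  nonY-↭ : ∀ {σ τ} → σ ↭ τ → nonY σ ≡ nonY τ
  nonY-↭ σ↭τ = ↭-length (filter-↭ (λ i → ¬? (Y? i)) σ↭τ)

  module _ (m c : ℕ) where

    insertions : List ℕ → Poly
    insertions σ = map (λ τ → (+ 1 , des X? Y? τ , c)) (inserts m σ)

    -- The letter a in front makes the descent at the first insertion position
    -- visible, which is what the recursion on σ needs.
    insertionsAfter : ℕ → List ℕ → Poly
    insertionsAfter a σ = map (λ τ → (+ 1 , des X? Y? (a ∷ τ) , c)) (inserts m σ)

    insertionsAfter-[] : ∀ {a} → a < m → insertionsAfter a [] ≡ (+ 1 , 0 , c) ∷ []
    insertionsAfter-[] a<m = cong (λ e → (+ 1 , e ℕ.+ 0 , c) ∷ []) (descent-< a<m)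

    insertionsAfter-∷ : ∀ {a b} σ → a < m →
      insertionsAfter a (b ∷ σ) ≡ (+ 1 , des X? Y? (m ∷ b ∷ σ) , c) ∷ x^ descent a b · insertionsAfter b σ
    insertionsAfter-∷ σ a<m =
      cong₂ _∷_ (cong (λ e → (+ 1 , e ℕ.+ _ , c)) (descent-< a<m))
                (trans (sym (map-∘ (inserts m σ))) (map-∘ (inserts m σ)))

    insertionsAfter-Φ : ¬ X m → ∀ {a} σ → a < m → All (_< m) σ →
                        insertionsAfter a σ ≋ φ-terms (length σ) (des X? Y? (a ∷ σ)) c
    insertionsAfter-Φ m∉X [] a<m [] = ≋-trans (≡⇒≋ (insertionsAfter-[] a<m)) (≋-sym (∷-drop-zero _))
    insertionsAfter-Φ m∉X {a} (b ∷ σ) a<m (b<m ∷ σ<m) = begin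
      insertionsAfter a (b ∷ σ)
        ≡⟨ insertionsAfter-∷ σ a<m ⟩
      (+ 1 , descent m b ℕ.+ d , c) ∷ x^ e · insertionsAfter b σ
        ≡⟨ cong (λ e′ → (+ 1 , e′ ℕ.+ d , c) ∷ x^ e · insertionsAfter b σ) (descent-no λ (_ , m∈X , _) → m∉X m∈X) ⟩
      (+ 1 , d , c) ∷ x^ e · insertionsAfter b σ
        ≈⟨ ∷-cong _ (x^-cong e (insertionsAfter-Φ m∉X σ b<m σ<m)) ⟩
      (+ 1 , d , c) ∷ x^ e · φ-terms (length σ) d c
        ≈⟨ φ-terms-step (length σ) d c (descent≤1 a b) ⟩
      φ-terms (suc (length σ)) (e ℕ.+ d) c
        ∎
      where
      open ≋-Reasoning
      d = des X? Y? (b ∷ σ)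
      e = descent a b

    insertionsAfter-Ψ : X m → ∀ {a} σ → a < m → All (_< m) σ →
                        insertionsAfter a σ ≋ ψ-terms (length σ) (des X? Y? (a ∷ σ)) (nonY σ) c
    insertionsAfter-Ψ m∈X [] a<m [] = ≋-trans (≡⇒≋ (insertionsAfter-[] a<m)) (≋-sym (∷-cong _ (∷-drop-zero _)))
    insertionsAfter-Ψ m∈X {a} (b ∷ σ) a<m (b<m ∷ σ<m) = by-Y (Y? b)
      where
      open ≋-Reasoning
      d = des X? Y? (b ∷ σ)
      e = descent a b
      IH : insertionsAfter b σ ≋ ψ-terms (length σ) d (nonY σ) c
      IH = insertionsAfter-Ψ m∈X σ b<m σ<m
      by-Y : Dec (Y b) → insertionsAfter a (b ∷ σ) ≋ ψ-terms (suc (length σ)) (e ℕ.+ d) (nonY (b ∷ σ)) c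
      by-Y (yes b∈Y) = begin
        insertionsAfter a (b ∷ σ)
          ≡⟨ insertionsAfter-∷ σ a<m ⟩
        (+ 1 , descent m b ℕ.+ d , c) ∷ x^ e · insertionsAfter b σ
          ≡⟨ cong (λ e′ → (+ 1 , e′ ℕ.+ d , c) ∷ x^ e · insertionsAfter b σ) (descent-yes (b<m , m∈X , b∈Y)) ⟩
        (+ 1 , suc d , c) ∷ x^ e · insertionsAfter b σ
          ≈⟨ ∷-cong _ (x^-cong e IH) ⟩
        (+ 1 , suc d , c) ∷ x^ e · ψ-terms (length σ) d (nonY σ) c
          ≈⟨ ψ-terms-step-∈ (length σ) d (nonY σ) c (descent≤1 a b) ⟩
        ψ-terms (suc (length σ)) (e ℕ.+ d) (nonY σ) c
          ≡⟨ cong (λ u → ψ-terms (suc (length σ)) (e ℕ.+ d) u c) (nonY-∈ σ b∈Y) ⟨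
        ψ-terms (suc (length σ)) (e ℕ.+ d) (nonY (b ∷ σ)) c
          ∎
      by-Y (no b∉Y) = begin
        insertionsAfter a (b ∷ σ)
          ≡⟨ insertionsAfter-∷ σ a<m ⟩
        (+ 1 , descent m b ℕ.+ d , c) ∷ x^ e · insertionsAfter b σ
          ≡⟨ cong₂ (λ e′ e″ → (+ 1 , e′ ℕ.+ d , c) ∷ x^ e″ · insertionsAfter b σ) (no-descent-into-b m) (no-descent-into-b a) ⟩
        (+ 1 , d , c) ∷ x^ 0 · insertionsAfter b σ
          ≈⟨ ∷-cong _ (x^-cong 0 IH) ⟩
        (+ 1 , d , c) ∷ ψ-terms (length σ) d (nonY σ) c
          ≈⟨ ψ-terms-step-∉ (length σ) d (nonY σ) c ⟩
        ψ-terms (suc (length σ)) d (suc (nonY σ)) c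
          ≡⟨ cong₂ (λ e′ u → ψ-terms (suc (length σ)) (e′ ℕ.+ d) u c) (no-descent-into-b a) (nonY-∉ σ b∉Y) ⟨
        ψ-terms (suc (length σ)) (e ℕ.+ d) (nonY (b ∷ σ)) c
          ∎
        where
        no-descent-into-b : ∀ a′ → descent a′ b ≡ 0
        no-descent-into-b a′ = descent-no {a′} (b∉Y ∘ proj₂ ∘ proj₂)

    insertions≡insertionsAfter0 : ∀ σ → insertions σ ≡ insertionsAfter 0 σ
    insertions≡insertionsAfter0 σ = map-cong (λ τ → cong (λ d → (+ 1 , d , c)) (sym (des-0∷ τ))) (inserts m σ)

    insertions-Φ : ¬ X m → 0 < m → ∀ σ → All (_< m) σ → insertions σ ≋ φ-terms (length σ) (des X? Y? σ) c
    insertions-Φ m∉X 0<m σ σ<m = begin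
      insertions σ                                  ≡⟨ insertions≡insertionsAfter0 σ ⟩
      insertionsAfter 0 σ                           ≈⟨ insertionsAfter-Φ m∉X σ 0<m σ<m ⟩
      φ-terms (length σ) (des X? Y? (0 ∷ σ)) c      ≡⟨ cong (λ d → φ-terms (length σ) d c) (des-0∷ σ) ⟩
      φ-terms (length σ) (des X? Y? σ) c            ∎
      where open ≋-Reasoning

    insertions-Ψ : X m → 0 < m → ∀ σ → All (_< m) σ → insertions σ ≋ ψ-terms (length σ) (des X? Y? σ) (nonY σ) c
    insertions-Ψ m∈X 0<m σ σ<m = begin
      insertions σ                                          ≡⟨ insertions≡insertionsAfter0 σ ⟩
      insertionsAfter 0 σ                                   ≈⟨ insertionsAfter-Ψ m∈X σ 0<m σ<m ⟩
      ψ-terms (length σ) (des X? Y? (0 ∷ σ)) (nonY σ) c     ≡⟨ cong (λ d → ψ-terms (length σ) d (nonY σ) c) (des-0∷ σ) ⟩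
      ψ-terms (length σ) (des X? Y? σ) (nonY σ) c           ∎
      where open ≋-Reasoning

  P≡ : ∀ n → P X? Y? n ≡ map (λ σ → (+ 1 , des X? Y? σ , compSize Y? n)) (S n)
  P≡ zero = refl
  P≡ (suc n) = refl

  module _ (n : ℕ) where

    private
      t = compSize Y? n

    length-perm : ∀ {σ} → σ ∈ S n → length σ ≡ n
    length-perm σ∈ = trans (↭-length (∈S⇒↭ n σ∈)) (length-[] n)

    perm-< : ∀ {σ} → σ ∈ S n → All (_< suc n) σ
    perm-< σ∈ = All.tabulate (λ x∈σ → s≤s (∈[]⇒≤ (∈-resp-↭ (∈S⇒↭ n σ∈) x∈σ)))

    compSize-suc-∈ : Y (suc n) → compSize Y? (suc n) ≡ t
    compSize-suc-∈ m∈Y = trans (nonY-↭ ([suc]↭ n)) (nonY-∈ [ n ] m∈Y)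

    compSize-suc-∉ : ¬ Y (suc n) → compSize Y? (suc n) ≡ suc t
    compSize-suc-∉ m∉Y = trans (nonY-↭ ([suc]↭ n)) (nonY-∉ [ n ] m∉Y)

    insertions-perm-Φ : ∀ {c σ} → ¬ X (suc n) → σ ∈ S n → insertions (suc n) c σ ≋ φ-terms n (des X? Y? σ) c
    insertions-perm-Φ {c} {σ} m∉X σ∈ =
      ≋-trans (insertions-Φ (suc n) c m∉X (s≤s z≤n) σ (perm-< σ∈))
              (≡⇒≋ (cong (λ k → φ-terms k (des X? Y? σ) c) (length-perm σ∈)))

    insertions-perm-Ψ : ∀ {c σ} → X (suc n) → σ ∈ S n → insertions (suc n) c σ ≋ ψ-terms n (des X? Y? σ) t c
    insertions-perm-Ψ {c} {σ} m∈X σ∈ =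
      ≋-trans (insertions-Ψ (suc n) c m∈X (s≤s z≤n) σ (perm-< σ∈))
              (≡⇒≋ (cong₂ (λ k u → ψ-terms k (des X? Y? σ) u c) (length-perm σ∈) (nonY-↭ (∈S⇒↭ n σ∈))))

    P-suc : ∀ F → Additive F →
            (∀ {σ} → σ ∈ S n → insertions (suc n) (compSize Y? (suc n)) σ ≋ F ((+ 1 , des X? Y? σ , t) ∷ [])) →
            P X? Y? (suc n) ≋ F (P X? Y? n)
    P-suc F F-additive insertions≋F = begin
      P X? Y? (suc n)                                       ≈⟨ ↭⇒≋ (map⁺ _ (S-suc↭ n)) ⟩
      map monomial′ (concatMap (inserts (suc n)) (S n))    ≡⟨ map-concatMap monomial′ (inserts (suc n)) (S n) ⟩
      concatMap (insertions (suc n) c′) (S n)               ≈⟨ concatMap-≋ F F-additive (S n) insertions≋F ⟩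
      F (map (λ σ → (+ 1 , des X? Y? σ , t)) (S n))         ≡⟨ cong F (P≡ n) ⟨
      F (P X? Y? n)                                         ∎
      where
      open ≋-Reasoning
      c′ = compSize Y? (suc n)
      monomial′ : List ℕ → Term
      monomial′ τ = (+ 1 , des X? Y? τ , c′)

    P-suc-∉X∉Y : ¬ X (suc n) → ¬ Y (suc n) → P X? Y? (suc n) ≋ yMul (Φ (suc n) (P X? Y? n))
    P-suc-∉X∉Y m∉X m∉Y = P-suc (yMul ∘ Φ (suc n)) (yMul-∘-additive (Φ (suc n)) (Φ-additive (suc n))) λ {σ} σ∈ → begin
      insertions (suc n) (compSize Y? (suc n)) σ   ≈⟨ insertions-perm-Φ m∉X σ∈ ⟩
      φ-terms n (des X? Y? σ) (compSize Y? (suc n))  ≡⟨ cong (φ-terms n (des X? Y? σ)) (compSize-suc-∉ m∉Y) ⟩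
      φ-terms n (des X? Y? σ) (suc t)                ≡⟨ cong yMul (Φ-monomial n (des X? Y? σ) t) ⟨
      yMul (Φ (suc n) ((+ 1 , des X? Y? σ , t) ∷ [])) ∎
      where open ≋-Reasoning

    P-suc-∉X∈Y : ¬ X (suc n) → Y (suc n) → P X? Y? (suc n) ≋ Φ (suc n) (P X? Y? n)
    P-suc-∉X∈Y m∉X m∈Y = P-suc (Φ (suc n)) (Φ-additive (suc n)) λ {σ} σ∈ → begin
      insertions (suc n) (compSize Y? (suc n)) σ   ≈⟨ insertions-perm-Φ m∉X σ∈ ⟩
      φ-terms n (des X? Y? σ) (compSize Y? (suc n))  ≡⟨ cong (φ-terms n (des X? Y? σ)) (compSize-suc-∈ m∈Y) ⟩
      φ-terms n (des X? Y? σ) t                      ≡⟨ Φ-monomial n (des X? Y? σ) t ⟨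
      Φ (suc n) ((+ 1 , des X? Y? σ , t) ∷ [])       ∎
      where open ≋-Reasoning

    P-suc-∈X∉Y : X (suc n) → ¬ Y (suc n) → P X? Y? (suc n) ≋ yMul (Ψ (suc n) (P X? Y? n))
    P-suc-∈X∉Y m∈X m∉Y = P-suc (yMul ∘ Ψ (suc n)) (yMul-∘-additive (Ψ (suc n)) (Ψ-additive (suc n))) λ {σ} σ∈ → begin
      insertions (suc n) (compSize Y? (suc n)) σ       ≈⟨ insertions-perm-Ψ m∈X σ∈ ⟩
      ψ-terms n (des X? Y? σ) t (compSize Y? (suc n))    ≡⟨ cong (ψ-terms n (des X? Y? σ) t) (compSize-suc-∉ m∉Y) ⟩
      ψ-terms n (des X? Y? σ) t (suc t)                  ≡⟨ cong yMul (Ψ-monomial n (des X? Y? σ) t) ⟨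
      yMul (Ψ (suc n) ((+ 1 , des X? Y? σ , t) ∷ []))    ∎
      where open ≋-Reasoning

    P-suc-∈X∈Y : X (suc n) → Y (suc n) → P X? Y? (suc n) ≋ Ψ (suc n) (P X? Y? n)
    P-suc-∈X∈Y m∈X m∈Y = P-suc (Ψ (suc n)) (Ψ-additive (suc n)) λ {σ} σ∈ → begin
      insertions (suc n) (compSize Y? (suc n)) σ       ≈⟨ insertions-perm-Ψ m∈X σ∈ ⟩
      ψ-terms n (des X? Y? σ) t (compSize Y? (suc n))    ≡⟨ cong (ψ-terms n (des X? Y? σ) t) (compSize-suc-∈ m∈Y) ⟩
      ψ-terms n (des X? Y? σ) t t                        ≡⟨ Ψ-monomial n (des X? Y? σ) t ⟨
      Ψ (suc n) ((+ 1 , des X? Y? σ , t) ∷ [])           ∎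
      where open ≋-Reasoning

proposition2p1 : {X Y : Subset} (X? : Decidable X) (Y? : Decidable Y) (n : ℕ) → n ≥ 1 →
    ((¬ X (suc n) → ¬ Y (suc n) → P X? Y? (suc n) ≈ₚ yMul (Φ (suc n) (P X? Y? n)))
    × (¬ X (suc n) → Y (suc n) → P X? Y? (suc n) ≈ₚ Φ (suc n) (P X? Y? n))
    × (X (suc n) → ¬ Y (suc n) → P X? Y? (suc n) ≈ₚ yMul (Ψ (suc n) (P X? Y? n)))
    × (X (suc n) → Y (suc n) → P X? Y? (suc n) ≈ₚ Ψ (suc n) (P X? Y? n)))
proposition2p1 X? Y? n _ =
    (λ m∉X m∉Y → coeff-≡ (P-suc-∉X∉Y X? Y? n m∉X m∉Y))
  , (λ m∉X m∈Y → coeff-≡ (P-suc-∉X∈Y X? Y? n m∉X m∈Y))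
  , (λ m∈X m∉Y → coeff-≡ (P-suc-∈X∉Y X? Y? n m∈X m∉Y))
  , (λ m∈X m∈Y → coeff-≡ (P-suc-∈X∈Y X? Y? n m∈X m∈Y))
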